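{- Let $\mathcal S$ be a cartesian closed category and $Q$ an object of $\mathcal S$. Then the functor $\mathbf{Rec}_Q\to\mathbf{Lam}$, $(A,R)\mapsto A$, is a cartesian closed bifibration: $\mathbf{Rec}_Q$ is cartesian closed, the functor strictly preserves finite products and internal homs, and it is both a Grothendieck fibration and an opfibration.
   Context: Simple types: $A,B::=A\times B\mid A\Rightarrow B\mid 1\mid o$. $\mathrm{Tm}(A)$: closed simply-typed $\lambda$-terms (with pairs, projections, unit) of type $A$ modulo $\beta\eta$. $\mathbf{Lam}$: the free cartesian closed category on one object $o$, with simple types as objects and closed terms of type $A\Rightarrow B$ modulo $\beta\eta$ as morphisms $A\to B$. $[\![-]\!]_Q:\mathbf{Lam}\to\mathcal S$ is the (unique up to iso) cartesian closed functor with $[\![o]\!]_Q=Q$; on a closed term $M$ of type $A$ it gives a global element $[\![M]\!]_Q$. Define the equivalence relation $M\sim_Q N$ iff $[\![M]\!]_Q=[\![N]\!]_Q$ on $\mathrm{Tm}(A)$, and the functor $\mathrm{Tm}_Q:\mathbf{Lam}\to\mathbf{Set}$ with $\mathrm{Tm}_Q(A)=\mathrm{Tm}(A)/\sim_Q$ and $\mathrm{Tm}_Q(M)([N])=[MN]$. Let $\mathbf{SubSet}$ be the category of pairs $(X,S)$ with $S\subseteq X$ a subset of a set, with morphisms $(X,S)\to(Y,T)$ the functions $f:X\to Y$ with $f(S)\subseteq T$. $\mathbf{Rec}_Q$ is the pullback of categories of $\mathbf{SubSet}\to\mathbf{Set}$ along $\mathrm{Tm}_Q$: objects are pairs $(A,R)$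 with $R\subseteq\mathrm{Tm}(A)/\sim_Q$ (equivalently, $\sim_Q$-saturated languages $L\subseteq \mathrm{Tm}(A)$), and morphisms $(A,R)\to(B,R')$ are morphisms $M:A\to B$ of $\mathbf{Lam}$ such that $[N]\in R$ implies $[MN]\in R'$. A fibration (resp. opfibration) is a functor admitting cartesian (resp. cocartesian) liftings of all base morphisms; a bifibration is both. -}

module Defs where

open import Level using (Level; _⊔_; suc; 0ℓ)
open import Data.Product using (Σ; _,_; proj₁; proj₂; _×_)
open import Relation.Binary.PropositionalEquality using (_≡_; refl)
open import Relation.Binary.Structures using (IsEquivalence)

infixr 7 _⇒_
infixr 8 _⊗_

data Ty : Set where
  o   : Ty
  𝟙   : Ty
  _⊗_ : Ty → Ty → Ty
  _⇒_ : Ty → Ty → Ty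

infixl 5 _▸_
data Ctx : Set where
  ∅   : Ctx
  _▸_ : Ctx → Ty → Ctx

variable
  Γ Δ : Ctx
  A B C : Ty

infix 4 _∋_
data _∋_ : Ctx → Ty → Set where
  ze : Γ ▸ A ∋ A
  su : Γ ∋ A → Γ ▸ B ∋ A

data Term (Γ : Ctx) : Ty → Set where
  var  : Γ ∋ A → Term Γ A
  lam  : Term (Γ ▸ A) B → Term Γ (A ⇒ B)
  app  : Term Γ (A ⇒ B) → Term Γ A → Term Γ B
  pair : Term Γ A → Term Γ B → Term Γ (A ⊗ B)
  fst  : Term Γ (A ⊗ B) → Term Γ A
  snd  : Term Γ (A ⊗ B) → Term Γ B
  unit : Term Γ 𝟙

Tm : Ty → Set
Tm A = Term ∅ A

Ren : Ctx → Ctx → Set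
Ren Γ Δ = ∀ {A} → Γ ∋ A → Δ ∋ A

ext : Ren Γ Δ → Ren (Γ ▸ B) (Δ ▸ B)
ext ρ ze     = ze
ext ρ (su x) = su (ρ x)

rename : Ren Γ Δ → Term Γ A → Term Δ A
rename ρ (var x)    = var (ρ x)
rename ρ (lam M)    = lam (rename (ext ρ) M)
rename ρ (app M N)  = app (rename ρ M) (rename ρ N)
rename ρ (pair M N) = pair (rename ρ M) (rename ρ N)
rename ρ (fst M)    = fst (rename ρ M)
rename ρ (snd M)    = snd (rename ρ M)
rename ρ unit       = unit

Sub : Ctx → Ctx → Set
Sub Γ Δ = ∀ {A} → Γ ∋ A → Term Δ A

exts : Sub Γ Δ → Sub (Γ ▸ B) (Δ ▸ B)
exts σ ze     = var ze
exts σ (su x) = rename su (σ x)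

sub : Sub Γ Δ → Term Γ A → Term Δ A
sub σ (var x)    = σ x
sub σ (lam M)    = lam (sub (exts σ) M)
sub σ (app M N)  = app (sub σ M) (sub σ N)
sub σ (pair M N) = pair (sub σ M) (sub σ N)
sub σ (fst M)    = fst (sub σ M)
sub σ (snd M)    = snd (sub σ M)
sub σ unit       = unit

single : Term Γ B → Sub (Γ ▸ B) Γ
single N ze     = N
single N (su x) = var x

_[_] : Term (Γ ▸ B) A → Term Γ B → Term Γ A
M [ N ] = sub (single N) M

wk : Term Γ A → Term (Γ ▸ B) A
wk = rename su

wkc : Tm A → Term Γ A
wkc = rename (λ ())

infix 4 _≈βη_
data _≈βη_ {Γ : Ctx} : {A : Ty} → Term Γ A → Term Γ A → Set where
  ≈refl  : {M : Term Γ A} → M ≈βη M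
  ≈sym   : {M N : Term Γ A} → M ≈βη N → N ≈βη M
  ≈trans : {M N L : Term Γ A} → M ≈βη N → N ≈βη L → M ≈βη L
  ξ-lam  : {M N : Term (Γ ▸ A) B} → _≈βη_ {Γ ▸ A} M N → lam M ≈βη lam N
  ξ-app  : {M M' : Term Γ (A ⇒ B)} {N N' : Term Γ A} →
           M ≈βη M' → N ≈βη N' → app M N ≈βη app M' N'
  ξ-pair : {M M' : Term Γ A} {N N' : Term Γ B} →
           M ≈βη M' → N ≈βη N' → pair M N ≈βη pair M' N'
  ξ-fst  : {M M' : Term Γ (A ⊗ B)} → M ≈βη M' → fst M ≈βη fst M'
  ξ-snd  : {M M' : Term Γ (A ⊗ B)} → M ≈βη M' → snd M ≈βη snd M'
  β-⇒    : {M : Term (Γ ▸ A) B} {N : Term Γ A} → app (lam M) N ≈βη M [ N ]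
  β-fst  : {M : Term Γ A} {N : Term Γ B} → fst (pair M N) ≈βη M
  β-snd  : {M : Term Γ A} {N : Term Γ B} → snd (pair M N) ≈βη N
  η-⇒    : {M : Term Γ (A ⇒ B)} → M ≈βη lam (app (wk M) (var ze))
  η-⊗    : {M : Term Γ (A ⊗ B)} → M ≈βη pair (fst M) (snd M)
  η-𝟙    : {M : Term Γ 𝟙} → M ≈βη unit

record Cat (o ℓ e : Level) : Set (suc (o ⊔ ℓ ⊔ e)) where
  infix 4 _≈_
  infixr 9 _∘_
  field
    Obj : Set o
    Hom : Obj → Obj → Set ℓ
    _≈_ : ∀ {X Y} → Hom X Y → Hom X Y → Set e
    id  : ∀ {X} → Hom X X
    _∘_ : ∀ {X Y Z} → Hom Y Z → Hom X Y → Hom X Z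

  eqArr : ∀ {X Y} → X ≡ Y → Hom X Y
  eqArr refl = id

record IsCategory {o ℓ e} (𝒞 : Cat o ℓ e) : Set (o ⊔ ℓ ⊔ e) where
  open Cat 𝒞
  field
    equiv     : ∀ {X Y} → IsEquivalence (_≈_ {X} {Y})
    ∘-resp-≈  : ∀ {X Y Z} {f h : Hom Y Z} {g i : Hom X Y} → f ≈ h → g ≈ i → f ∘ g ≈ h ∘ i
    identityˡ : ∀ {X Y} {f : Hom X Y} → id ∘ f ≈ f
    identityʳ : ∀ {X Y} {f : Hom X Y} → f ∘ id ≈ f
    assoc     : ∀ {W X Y Z} {f : Hom W X} {g : Hom X Y} {h : Hom Y Z} →
                (h ∘ g) ∘ f ≈ h ∘ (g ∘ f)

record CCOps {o ℓ e} (𝒞 : Cat o ℓ e) : Set (o ⊔ ℓ) where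
  open Cat 𝒞
  infixr 8 _⊠_
  infixr 7 _⇨_
  field
    ⊤     : Obj
    !     : ∀ {X} → Hom X ⊤
    _⊠_   : Obj → Obj → Obj
    π₁    : ∀ {X Y} → Hom (X ⊠ Y) X
    π₂    : ∀ {X Y} → Hom (X ⊠ Y) Y
    ⟨_,_⟩ : ∀ {Z X Y} → Hom Z X → Hom Z Y → Hom Z (X ⊠ Y)
    _⇨_   : Obj → Obj → Obj
    eval  : ∀ {X Y} → Hom ((X ⇨ Y) ⊠ X) Y
    curry : ∀ {Z X Y} → Hom (Z ⊠ X) Y → Hom Z (X ⇨ Y)

  infixr 8 _⊠₁_
  _⊠₁_ : ∀ {X X' Y Y'} → Hom X X' → Hom Y Y' → Hom (X ⊠ Y) (X' ⊠ Y')
  f ⊠₁ g = ⟨ f ∘ π₁ , g ∘ π₂ ⟩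

record IsCCC {o ℓ e} (𝒞 : Cat o ℓ e) (ops : CCOps 𝒞) : Set (o ⊔ ℓ ⊔ e) where
  open Cat 𝒞
  open CCOps ops
  field
    isCategory   : IsCategory 𝒞
    !-unique     : ∀ {X} (f : Hom X ⊤) → f ≈ !
    π₁-β         : ∀ {Z X Y} {f : Hom Z X} {g : Hom Z Y} → π₁ ∘ ⟨ f , g ⟩ ≈ f
    π₂-β         : ∀ {Z X Y} {f : Hom Z X} {g : Hom Z Y} → π₂ ∘ ⟨ f , g ⟩ ≈ g
    ⟨⟩-unique    : ∀ {Z X Y} {f : Hom Z X} {g : Hom Z Y} {h : Hom Z (X ⊠ Y)} →
                   π₁ ∘ h ≈ f → π₂ ∘ h ≈ g → h ≈ ⟨ f , g ⟩
    curry-β      : ∀ {Z X Y} {f : Hom (Z ⊠ X) Y} → eval ∘ (curry f ⊠₁ id) ≈ f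
    curry-unique : ∀ {Z X Y} {f : Hom (Z ⊠ X) Y} {h : Hom Z (X ⇨ Y)} →
                   eval ∘ (h ⊠₁ id) ≈ f → h ≈ curry f

record CCC (o ℓ e : Level) : Set (suc (o ⊔ ℓ ⊔ e)) where
  field
    cat   : Cat o ℓ e
    ops   : CCOps cat
    isCCC : IsCCC cat ops
  open Cat cat public
  open CCOps ops public

record Functor {o ℓ e o' ℓ' e'} (𝒞 : Cat o ℓ e) (𝒟 : Cat o' ℓ' e')
       : Set (o ⊔ ℓ ⊔ o' ⊔ ℓ') where
  field
    F₀ : Cat.Obj 𝒞 → Cat.Obj 𝒟
    F₁ : ∀ {X Y} → Cat.Hom 𝒞 X Y → Cat.Hom 𝒟 (F₀ X) (F₀ Y)

module _ {o ℓ e o' ℓ' e'} {𝒞 : Cat o ℓ e} {𝒟 : Cat o' ℓ' e'} where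
  private
    module C = Cat 𝒞
    module D = Cat 𝒟

  record StrictCC (CO : CCOps 𝒞) (DO : CCOps 𝒟) (F : Functor 𝒞 𝒟)
         : Set (o ⊔ ℓ ⊔ o' ⊔ e') where
    private
      module CO = CCOps CO
      module DO = CCOps DO
    open Functor F
    field
      ⊤-eq    : F₀ CO.⊤ ≡ DO.⊤
      ⊠-eq    : ∀ X Y → F₀ (X CO.⊠ Y) ≡ F₀ X DO.⊠ F₀ Y
      π₁-eq   : ∀ X Y → F₁ (CO.π₁ {X} {Y}) D.≈ DO.π₁ D.∘ D.eqArr (⊠-eq X Y)
      π₂-eq   : ∀ X Y → F₁ (CO.π₂ {X} {Y}) D.≈ DO.π₂ D.∘ D.eqArr (⊠-eq X Y)
      ⇨-eq    : ∀ X Y → F₀ (X CO.⇨ Y) ≡ F₀ X DO.⇨ F₀ Y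
      eval-eq : ∀ X Y → F₁ (CO.eval {X} {Y}) D.≈
                  DO.eval D.∘ (D.eqArr (⇨-eq X Y) DO.⊠₁ D.id) D.∘ D.eqArr (⊠-eq (X CO.⇨ Y) X)

  module _ (F : Functor 𝒞 𝒟) where
    open Functor F

    IsCartesian : ∀ {X Y} → C.Hom X Y → Set (o ⊔ ℓ ⊔ e ⊔ ℓ' ⊔ e')
    IsCartesian {X} {Y} φ =
      ∀ {Z} (ψ : C.Hom Z Y) (g : D.Hom (F₀ Z) (F₀ X)) → F₁ φ D.∘ g D.≈ F₁ ψ →
      Σ (C.Hom Z X) λ χ → (F₁ χ D.≈ g × φ C.∘ χ C.≈ ψ) ×
        (∀ (χ' : C.Hom Z X) → F₁ χ' D.≈ g → φ C.∘ χ' C.≈ ψ → χ' C.≈ χ)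

    IsCocartesian : ∀ {X Y} → C.Hom X Y → Set (o ⊔ ℓ ⊔ e ⊔ ℓ' ⊔ e')
    IsCocartesian {X} {Y} φ =
      ∀ {Z} (ψ : C.Hom X Z) (g : D.Hom (F₀ Y) (F₀ Z)) → g D.∘ F₁ φ D.≈ F₁ ψ →
      Σ (C.Hom Y Z) λ χ → (F₁ χ D.≈ g × χ C.∘ φ C.≈ ψ) ×
        (∀ (χ' : C.Hom Y Z) → F₁ χ' D.≈ g → χ' C.∘ φ C.≈ ψ → χ' C.≈ χ)

    Fibration : Set (o ⊔ ℓ ⊔ e ⊔ o' ⊔ ℓ' ⊔ e')
    Fibration = ∀ {A Y} (f : D.Hom A (F₀ Y)) →
      Σ C.Obj λ X → Σ (F₀ X ≡ A) λ eq → Σ (C.Hom X Y) λ φ →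
        F₁ φ D.≈ f D.∘ D.eqArr eq × IsCartesian φ

    Opfibration : Set (o ⊔ ℓ ⊔ e ⊔ o' ⊔ ℓ' ⊔ e')
    Opfibration = ∀ {X A} (f : D.Hom (F₀ X) A) →
      Σ C.Obj λ Y → Σ (F₀ Y ≡ A) λ eq → Σ (C.Hom X Y) λ φ →
        D.eqArr eq D.∘ F₁ φ D.≈ f × IsCocartesian φ

-- Lam: the free CCC on o (closed terms of type A ⇒ B modulo βη)

Lam : Cat 0ℓ 0ℓ 0ℓ
Lam = record
  { Obj = Ty
  ; Hom = λ A B → Tm (A ⇒ B)
  ; _≈_ = _≈βη_
  ; id  = lam (var ze)
  ; _∘_ = λ g f → lam (app (wkc g) (app (wkc f) (var ze)))
  }

LamOps : CCOps Lam
LamOps = record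
  { ⊤     = 𝟙
  ; !     = lam unit
  ; _⊠_   = _⊗_
  ; π₁    = lam (fst (var ze))
  ; π₂    = lam (snd (var ze))
  ; ⟨_,_⟩ = λ f g → lam (pair (app (wkc f) (var ze)) (app (wkc g) (var ze)))
  ; _⇨_   = _⇒_
  ; eval  = lam (app (fst (var ze)) (snd (var ze)))
  ; curry = λ f → lam (lam (app (wkc f) (pair (var (su ze)) (var ze))))
  }

module Interp {o′ ℓ e} (S : CCC o′ ℓ e) (Q : CCC.Obj S) where
  open CCC S

  ⟦_⟧ty : Ty → Obj
  ⟦ o ⟧ty     = Q
  ⟦ 𝟙 ⟧ty     = ⊤
  ⟦ A ⊗ B ⟧ty = ⟦ A ⟧ty ⊠ ⟦ B ⟧ty
  ⟦ A ⇒ B ⟧ty = ⟦ A ⟧ty ⇨ ⟦ B ⟧ty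

  ⟦_⟧ctx : Ctx → Obj
  ⟦ ∅ ⟧ctx     = ⊤
  ⟦ Γ ▸ A ⟧ctx = ⟦ Γ ⟧ctx ⊠ ⟦ A ⟧ty

  ⟦_⟧var : Γ ∋ A → Hom ⟦ Γ ⟧ctx ⟦ A ⟧ty
  ⟦ ze ⟧var   = π₂
  ⟦ su x ⟧var = ⟦ x ⟧var ∘ π₁

  ⟦_⟧ : Term Γ A → Hom ⟦ Γ ⟧ctx ⟦ A ⟧ty
  ⟦ var x ⟧    = ⟦ x ⟧var
  ⟦ lam M ⟧    = curry ⟦ M ⟧
  ⟦ app M N ⟧  = eval ∘ ⟨ ⟦ M ⟧ , ⟦ N ⟧ ⟩
  ⟦ pair M N ⟧ = ⟨ ⟦ M ⟧ , ⟦ N ⟧ ⟩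
  ⟦ fst M ⟧    = π₁ ∘ ⟦ M ⟧
  ⟦ snd M ⟧    = π₂ ∘ ⟦ M ⟧
  ⟦ unit ⟧     = !

  infix 4 _~Q_
  _~Q_ : Tm A → Tm A → Set e
  M ~Q N = ⟦ M ⟧ ≈ ⟦ N ⟧

module RecQ {o′ ℓ e} (S : CCC o′ ℓ e) (Q : CCC.Obj S) (r : Level) where
  open Interp S Q

  -- objects (A , R) with R a ~_Q-saturated predicate on closed terms of type A,
  -- i.e. a subset of Tm(A)/~_Q
  record RecObj : Set (suc (e ⊔ r)) where
    field
      ty        : Ty
      pred      : Tm ty → Set (e ⊔ r)
      saturated : ∀ {M N : Tm ty} → M ~Q N → pred M → pred N
  open RecObj public

  RecHom : RecObj → RecObj → Set (e ⊔ r)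
  RecHom X Y = Σ (Tm (ty X ⇒ ty Y)) λ M → ∀ (N : Tm (ty X)) → pred X N → pred Y (app M N)

  record RecCatLaws : Set (suc (e ⊔ r)) where
    field
      id-pres   : ∀ (X : RecObj) (N : Tm (ty X)) → pred X N →
                  pred X (app (Cat.id Lam) N)
      comp-pres : ∀ {X Y Z : RecObj} (g : RecHom Y Z) (f : RecHom X Y)
                  (N : Tm (ty X)) → pred X N →
                  pred Z (app (Cat._∘_ Lam (proj₁ g) (proj₁ f)) N)

  RecCat : RecCatLaws → Cat (suc (e ⊔ r)) (e ⊔ r) 0ℓ
  RecCat L = record
    { Obj = RecObj
    ; Hom = RecHom
    ; _≈_ = λ f g → proj₁ f ≈βη proj₁ g
    ; id  = λ {X} → Cat.id Lam , RecCatLaws.id-pres L X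
    ; _∘_ = λ {X} {Y} {Z} g f → Cat._∘_ Lam (proj₁ g) (proj₁ f) , RecCatLaws.comp-pres L {X} {Y} {Z} g f
    }

  P : (L : RecCatLaws) → Functor (RecCat L) Lam
  P L = record { F₀ = ty ; F₁ = proj₁ }

-- The structure of Rec_Q is lifted from Lam by the clauses of a logical relation:
-- products and exponentials of predicates are componentwise and "related arguments
-- to related results", cartesian liftings are preimages and cocartesian liftings are
-- direct images closed under ~Q. Each clause yields a ~Q-saturated predicate, and the
-- only βη-reasoning needed inside predicates is supplied by soundness of the
-- interpretation in S: βη-convertible terms have equal denotations. All laws, and
-- the uniqueness of the liftings, hold because morphisms of Rec_Q are compared as
-- morphisms of Lam, which is itself a CCC.
module Submission where

open import Defs
open import Level using (Level; Lift; lift; _⊔_; 0ℓ)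
open import Data.Unit using (tt) renaming (⊤ to Unit)
open import Data.Product using (Σ; _×_; _,_)
open import Relation.Binary.PropositionalEquality using (_≡_; refl; cong; cong₂; sym; trans)
open import Relation.Binary.Structures using (IsEquivalence)
open import Relation.Binary.Bundles using (Setoid)
import Relation.Binary.Reasoning.Setoid as SetoidReasoning

variable
  Θ : Ctx
  D : Ty

≡⇒≈βη : {M N : Term Γ A} → M ≡ N → M ≈βη N
≡⇒≈βη refl = ≈refl

ext-∘ : (ρ : Ren Γ Δ) (ρ′ : Ren Δ Θ) (ρ″ : Ren Γ Θ) →
        (∀ {A} (x : Γ ∋ A) → ρ′ (ρ x) ≡ ρ″ x) →
        ∀ {A} (x : Γ ▸ B ∋ A) → ext ρ′ (ext ρ x) ≡ ext ρ″ x
ext-∘ ρ ρ′ ρ″ h ze     = refl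
ext-∘ ρ ρ′ ρ″ h (su x) = cong su (h x)

rename-rename : (ρ : Ren Γ Δ) (ρ′ : Ren Δ Θ) (ρ″ : Ren Γ Θ) →
                (∀ {A} (x : Γ ∋ A) → ρ′ (ρ x) ≡ ρ″ x) →
                (M : Term Γ A) → rename ρ′ (rename ρ M) ≡ rename ρ″ M
rename-rename ρ ρ′ ρ″ h (var x)    = cong var (h x)
rename-rename ρ ρ′ ρ″ h (lam M)    =
  cong lam (rename-rename (ext ρ) (ext ρ′) (ext ρ″) (ext-∘ ρ ρ′ ρ″ h) M)
rename-rename ρ ρ′ ρ″ h (app M N)  = cong₂ app (rename-rename ρ ρ′ ρ″ h M) (rename-rename ρ ρ′ ρ″ h N)
rename-rename ρ ρ′ ρ″ h (pair M N) = cong₂ pair (rename-rename ρ ρ′ ρ″ h M) (rename-rename ρ ρ′ ρ″ h N)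
rename-rename ρ ρ′ ρ″ h (fst M)    = cong fst (rename-rename ρ ρ′ ρ″ h M)
rename-rename ρ ρ′ ρ″ h (snd M)    = cong snd (rename-rename ρ ρ′ ρ″ h M)
rename-rename ρ ρ′ ρ″ h unit       = refl

rename-id : (ρ : Ren Γ Γ) → (∀ {A} (x : Γ ∋ A) → ρ x ≡ x) → (M : Term Γ A) → rename ρ M ≡ M
rename-id ρ h (var x)    = cong var (h x)
rename-id ρ h (lam M)    = cong lam (rename-id (ext ρ) h′ M)
  where h′ : ∀ {A} (x : _ ▸ _ ∋ A) → ext ρ x ≡ x
        h′ ze     = refl
        h′ (su x) = cong su (h x)
rename-id ρ h (app M N)  = cong₂ app (rename-id ρ h M) (rename-id ρ h N)
rename-id ρ h (pair M N) = cong₂ pair (rename-id ρ h M) (rename-id ρ h N)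
rename-id ρ h (fst M)    = cong fst (rename-id ρ h M)
rename-id ρ h (snd M)    = cong snd (rename-id ρ h M)
rename-id ρ h unit       = refl

rename-cong : (ρ ρ′ : Ren Γ Δ) → (∀ {A} (x : Γ ∋ A) → ρ x ≡ ρ′ x) →
              (M : Term Γ A) → rename ρ M ≡ rename ρ′ M
rename-cong ρ ρ′ h M = trans (cong (rename ρ) (sym (rename-id (λ x → x) (λ x → refl) M)))
                             (rename-rename (λ x → x) ρ ρ′ h M)

sub-rename : (ρ : Ren Γ Δ) (σ : Sub Δ Θ) (τ : Sub Γ Θ) → (∀ {A} (x : Γ ∋ A) → σ (ρ x) ≡ τ x) →
             (M : Term Γ A) → sub σ (rename ρ M) ≡ sub τ M
sub-rename ρ σ τ h (var x)    = h x
sub-rename ρ σ τ h (lam M)    = cong lam (sub-rename (ext ρ) (exts σ) (exts τ) h′ M)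
  where h′ : ∀ {A} (x : _ ▸ _ ∋ A) → exts σ (ext ρ x) ≡ exts τ x
        h′ ze     = refl
        h′ (su x) = cong wk (h x)
sub-rename ρ σ τ h (app M N)  = cong₂ app (sub-rename ρ σ τ h M) (sub-rename ρ σ τ h N)
sub-rename ρ σ τ h (pair M N) = cong₂ pair (sub-rename ρ σ τ h M) (sub-rename ρ σ τ h N)
sub-rename ρ σ τ h (fst M)    = cong fst (sub-rename ρ σ τ h M)
sub-rename ρ σ τ h (snd M)    = cong snd (sub-rename ρ σ τ h M)
sub-rename ρ σ τ h unit       = refl

rename-wk : (ρ : Ren Γ Δ) (M : Term Γ A) → rename (ext {B = B} ρ) (wk M) ≡ wk (rename ρ M)
rename-wk ρ M = trans (rename-rename su (ext ρ) (λ y → su (ρ y)) (λ y → refl) M)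
                      (sym (rename-rename ρ su (λ y → su (ρ y)) (λ y → refl) M))

rename-sub : (σ : Sub Γ Δ) (ρ : Ren Δ Θ) (τ : Sub Γ Θ) →
             (∀ {A} (x : Γ ∋ A) → rename ρ (σ x) ≡ τ x) →
             (M : Term Γ A) → rename ρ (sub σ M) ≡ sub τ M
rename-sub σ ρ τ h (var x)    = h x
rename-sub σ ρ τ h (lam M)    = cong lam (rename-sub (exts σ) (ext ρ) (exts τ) h′ M)
  where h′ : ∀ {A} (x : _ ▸ _ ∋ A) → rename (ext ρ) (exts σ x) ≡ exts τ x
        h′ ze     = refl
        h′ (su x) = trans (rename-wk ρ (σ x)) (cong wk (h x))
rename-sub σ ρ τ h (app M N)  = cong₂ app (rename-sub σ ρ τ h M) (rename-sub σ ρ τ h N)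
rename-sub σ ρ τ h (pair M N) = cong₂ pair (rename-sub σ ρ τ h M) (rename-sub σ ρ τ h N)
rename-sub σ ρ τ h (fst M)    = cong fst (rename-sub σ ρ τ h M)
rename-sub σ ρ τ h (snd M)    = cong snd (rename-sub σ ρ τ h M)
rename-sub σ ρ τ h unit       = refl

sub-var-rename : (σ : Sub Γ Δ) (ρ : Ren Γ Δ) → (∀ {A} (x : Γ ∋ A) → σ x ≡ var (ρ x)) →
                 (M : Term Γ A) → sub σ M ≡ rename ρ M
sub-var-rename σ ρ h (var x)    = h x
sub-var-rename σ ρ h (lam M)    = cong lam (sub-var-rename (exts σ) (ext ρ) h′ M)
  where h′ : ∀ {A} (x : _ ▸ _ ∋ A) → exts σ x ≡ var (ext ρ x)
        h′ ze     = refl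
        h′ (su x) = cong wk (h x)
sub-var-rename σ ρ h (app M N)  = cong₂ app (sub-var-rename σ ρ h M) (sub-var-rename σ ρ h N)
sub-var-rename σ ρ h (pair M N) = cong₂ pair (sub-var-rename σ ρ h M) (sub-var-rename σ ρ h N)
sub-var-rename σ ρ h (fst M)    = cong fst (sub-var-rename σ ρ h M)
sub-var-rename σ ρ h (snd M)    = cong snd (sub-var-rename σ ρ h M)
sub-var-rename σ ρ h unit       = refl

wk-[] : (M : Term Γ A) (N : Term Γ B) → wk M [ N ] ≡ M
wk-[] M N = trans (sub-rename su (single N) var (λ x → refl) M)
                  (trans (sub-var-rename var (λ x → x) (λ x → refl) M) (rename-id (λ x → x) (λ x → refl) M))

rename-wkc : (ρ : Ren Γ Δ) (M : Tm A) → rename ρ (wkc {Γ = Γ} M) ≡ wkc M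
rename-wkc ρ = rename-rename _ ρ _ (λ ())

sub-wkc : (σ : Sub Γ Δ) (M : Tm A) → sub σ (wkc {Γ = Γ} M) ≡ wkc M
sub-wkc σ M = trans (sub-rename _ σ (λ ()) (λ ()) M) (sub-var-rename (λ ()) _ (λ ()) M)

wkc-∅ : (M : Tm A) → wkc {Γ = ∅} M ≡ M
wkc-∅ = rename-id _ (λ ())

wk-closed : (M : Tm A) → wk {B = B} M ≡ wkc M
wk-closed = rename-cong su _ (λ ())

rename-≈βη : (ρ : Ren Γ Δ) {M N : Term Γ A} → M ≈βη N → rename ρ M ≈βη rename ρ N
rename-≈βη ρ ≈refl         = ≈refl
rename-≈βη ρ (≈sym p)      = ≈sym (rename-≈βη ρ p)
rename-≈βη ρ (≈trans p q)  = ≈trans (rename-≈βη ρ p) (rename-≈βη ρ q)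
rename-≈βη ρ (ξ-lam p)     = ξ-lam (rename-≈βη (ext ρ) p)
rename-≈βη ρ (ξ-app p q)   = ξ-app (rename-≈βη ρ p) (rename-≈βη ρ q)
rename-≈βη ρ (ξ-pair p q)  = ξ-pair (rename-≈βη ρ p) (rename-≈βη ρ q)
rename-≈βη ρ (ξ-fst p)     = ξ-fst (rename-≈βη ρ p)
rename-≈βη ρ (ξ-snd p)     = ξ-snd (rename-≈βη ρ p)
rename-≈βη ρ (β-⇒ {M = M} {N = N}) = ≈trans β-⇒ (≡⇒≈βη (trans
  (sub-rename (ext ρ) (single (rename ρ N)) (λ x → rename ρ (single N x)) single-ext M)
  (sym (rename-sub (single N) ρ _ (λ x → refl) M))))
  where single-ext : ∀ {A} (x : _ ∋ A) → single (rename ρ N) (ext ρ x) ≡ rename ρ (single N x)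
        single-ext ze     = refl
        single-ext (su x) = refl
rename-≈βη ρ β-fst         = β-fst
rename-≈βη ρ β-snd         = β-snd
rename-≈βη ρ (η-⇒ {M = M}) =
  ≈trans η-⇒ (≡⇒≈βη (cong (λ z → lam (app z (var ze))) (sym (rename-wk ρ M))))
rename-≈βη ρ η-⊗           = η-⊗
rename-≈βη ρ η-𝟙           = η-𝟙

sub-rename-wkc : (ρ : Ren Γ Δ) (σ : Sub Δ Θ) (M : Tm A) → sub σ (rename ρ (wkc {Γ = Γ} M)) ≡ wkc M
sub-rename-wkc ρ σ M = trans (cong (sub σ) (rename-wkc ρ M)) (sub-wkc σ M)

≈βη-setoid : Ctx → Ty → Setoid 0ℓ 0ℓ
≈βη-setoid Γ A = record
  { Carrier = Term Γ A ; _≈_ = _≈βη_ ; isEquivalence = record { refl = ≈refl ; sym = ≈sym ; trans = ≈trans } }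

module ≈βη-Reasoning {Γ A} = SetoidReasoning (≈βη-setoid Γ A)

module LO = CCOps LamOps

infixr 9 _∘L_
_∘L_ : Tm (B ⇒ C) → Tm (A ⇒ B) → Tm (A ⇒ C)
_∘L_ = Cat._∘_ Lam

idL : Tm (A ⇒ A)
idL = Cat.id Lam

infixr 9 _·_
_·_ : Tm (A ⇒ B) → Term Γ A → Term Γ B
f · t = app (wkc f) t

app-∅ : (f : Tm (A ⇒ B)) (t : Tm A) → app f t ≈βη f · t
app-∅ f t = ≡⇒≈βη (cong₂ app (sym (wkc-∅ f)) refl)

·-cong : {f g : Tm (A ⇒ B)} {s t : Term Γ A} → f ≈βη g → s ≈βη t → f · s ≈βη g · t
·-cong p q = ξ-app (rename-≈βη _ p) q

·-ext : {f g : Tm (A ⇒ B)} → f · var {Γ = ∅ ▸ A} ze ≈βη g · var ze → f ≈βη g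
·-ext {f = f} {g} p = ≈trans (η-expand f) (≈trans (ξ-lam p) (≈sym (η-expand g)))
  where η-expand : (h : Tm (A ⇒ B)) → h ≈βη lam (h · var ze)
        η-expand h = ≈trans η-⇒ (≡⇒≈βη (cong (λ z → lam (app z (var ze))) (wk-closed h)))

id-· : (t : Term Γ A) → idL · t ≈βη t
id-· t = β-⇒

∘-· : (g : Tm (B ⇒ C)) (f : Tm (A ⇒ B)) (t : Term Γ A) → (g ∘L f) · t ≈βη g · f · t
∘-· g f t = ≈trans β-⇒ (≡⇒≈βη (cong₂ app (sub-rename-wkc (ext _) (single t) g)
                                         (cong₂ app (sub-rename-wkc (ext _) (single t) f) refl)))

!-· : (t : Term Γ A) → LO.! · t ≈βη unit
!-· t = β-⇒

π₁-· : (t : Term Γ (A ⊗ B)) → LO.π₁ · t ≈βη fst t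
π₁-· t = β-⇒

π₂-· : (t : Term Γ (A ⊗ B)) → LO.π₂ · t ≈βη snd t
π₂-· t = β-⇒

⟨,⟩-· : (f : Tm (C ⇒ A)) (g : Tm (C ⇒ B)) (t : Term Γ C) → LO.⟨ f , g ⟩ · t ≈βη pair (f · t) (g · t)
⟨,⟩-· f g t = ≈trans β-⇒ (≡⇒≈βη (cong₂ pair (cong₂ app (sub-rename-wkc (ext _) (single t) f) refl)
                                           (cong₂ app (sub-rename-wkc (ext _) (single t) g) refl)))

eval-· : (t : Term Γ ((A ⇒ B) ⊗ A)) → LO.eval · t ≈βη app (fst t) (snd t)
eval-· t = β-⇒

curry-· : (f : Tm (C ⊗ A ⇒ B)) (s : Term Γ C) → LO.curry f · s ≈βη lam (f · pair (wk s) (var ze))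
curry-· f s = ≈trans β-⇒ (≡⇒≈βη (cong (λ z → lam (app z (pair (wk s) (var ze))))
                                      (sub-rename-wkc (ext (ext _)) (exts (single s)) f)))

curry-·-· : (f : Tm (C ⊗ A ⇒ B)) (s : Term Γ C) (t : Term Γ A) → app (LO.curry f · s) t ≈βη f · pair s t
curry-·-· f s t = ≈trans (ξ-app (curry-· f s) ≈refl) (≈trans β-⇒
  (≡⇒≈βη (cong₂ app (sub-wkc (single t) f) (cong₂ pair (wk-[] s t) refl))))

⊠₁id-· : (h : Tm (C ⇒ B)) (t : Term Γ (C ⊗ A)) → (h LO.⊠₁ idL) · t ≈βη pair (h · fst t) (snd t)
⊠₁id-· h t = ≈trans (⟨,⟩-· _ _ t) (ξ-pair (≈trans (∘-· h LO.π₁ t) (·-cong ≈refl (π₁-· t)))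
                                          (≈trans (∘-· idL LO.π₂ t) (≈trans (id-· _) (π₂-· t))))

eval∘⊠₁id-· : (h : Tm (C ⇒ A ⇒ B)) (t : Term Γ (C ⊗ A)) →
              (LO.eval ∘L (h LO.⊠₁ idL)) · t ≈βη app (h · fst t) (snd t)
eval∘⊠₁id-· h t = begin
  (LO.eval ∘L (h LO.⊠₁ idL)) · t             ≈⟨ ∘-· LO.eval _ t ⟩
  LO.eval · (h LO.⊠₁ idL) · t                ≈⟨ eval-· _ ⟩
  app (fst ((h LO.⊠₁ idL) · t)) (snd ((h LO.⊠₁ idL) · t))
    ≈⟨ ξ-app (≈trans (ξ-fst (⊠₁id-· h t)) β-fst) (≈trans (ξ-snd (⊠₁id-· h t)) β-snd) ⟩
  app (h · fst t) (snd t)                    ∎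
  where open ≈βη-Reasoning

Lam-∘-resp-≈ : {f h : Tm (B ⇒ C)} {g i : Tm (A ⇒ B)} → f ≈βη h → g ≈βη i → f ∘L g ≈βη h ∘L i
Lam-∘-resp-≈ p q = ξ-lam (·-cong p (·-cong q ≈refl))

Lam-!-unique : (f : Tm (A ⇒ 𝟙)) → f ≈βη LO.!
Lam-!-unique f = ·-ext (≈trans η-𝟙 (≈sym (!-· _)))

Lam-identityˡ : {f : Tm (A ⇒ B)} → idL ∘L f ≈βη f
Lam-identityˡ {f = f} = ·-ext (≈trans (∘-· idL f _) (id-· _))

Lam-identityʳ : {f : Tm (A ⇒ B)} → f ∘L idL ≈βη f
Lam-identityʳ {f = f} = ·-ext (≈trans (∘-· f idL _) (·-cong ≈refl (id-· _)))

Lam-assoc : {f : Tm (A ⇒ B)} {g : Tm (B ⇒ C)} {h : Tm (C ⇒ D)} → (h ∘L g) ∘L f ≈βη h ∘L (g ∘L f)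
Lam-assoc {f = f} {g} {h} = ·-ext (begin
  ((h ∘L g) ∘L f) · var ze ≈⟨ ∘-· (h ∘L g) f _ ⟩
  (h ∘L g) · f · var ze    ≈⟨ ∘-· h g _ ⟩
  h · g · f · var ze       ≈⟨ ·-cong ≈refl (∘-· g f _) ⟨
  h · (g ∘L f) · var ze    ≈⟨ ∘-· h (g ∘L f) _ ⟨
  (h ∘L (g ∘L f)) · var ze ∎)
  where open ≈βη-Reasoning

Lam-π₁-β : {f : Tm (C ⇒ A)} {g : Tm (C ⇒ B)} → LO.π₁ ∘L LO.⟨ f , g ⟩ ≈βη f
Lam-π₁-β {f = f} {g} = ·-ext (begin
  (LO.π₁ ∘L LO.⟨ f , g ⟩) · var ze ≈⟨ ∘-· LO.π₁ LO.⟨ f , g ⟩ _ ⟩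
  LO.π₁ · LO.⟨ f , g ⟩ · var ze    ≈⟨ π₁-· _ ⟩
  fst (LO.⟨ f , g ⟩ · var ze)      ≈⟨ ξ-fst (⟨,⟩-· f g _) ⟩
  fst (pair (f · var ze) _)        ≈⟨ β-fst ⟩
  f · var ze                       ∎)
  where open ≈βη-Reasoning

Lam-π₂-β : {f : Tm (C ⇒ A)} {g : Tm (C ⇒ B)} → LO.π₂ ∘L LO.⟨ f , g ⟩ ≈βη g
Lam-π₂-β {f = f} {g} = ·-ext (begin
  (LO.π₂ ∘L LO.⟨ f , g ⟩) · var ze ≈⟨ ∘-· LO.π₂ LO.⟨ f , g ⟩ _ ⟩
  LO.π₂ · LO.⟨ f , g ⟩ · var ze    ≈⟨ π₂-· _ ⟩
  snd (LO.⟨ f , g ⟩ · var ze)      ≈⟨ ξ-snd (⟨,⟩-· f g _) ⟩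
  snd (pair _ (g · var ze))        ≈⟨ β-snd ⟩
  g · var ze                       ∎)
  where open ≈βη-Reasoning

Lam-⟨⟩-unique : {f : Tm (C ⇒ A)} {g : Tm (C ⇒ B)} {h : Tm (C ⇒ A ⊗ B)} →
                LO.π₁ ∘L h ≈βη f → LO.π₂ ∘L h ≈βη g → h ≈βη LO.⟨ f , g ⟩
Lam-⟨⟩-unique {f = f} {g} {h} p q = ·-ext (begin
  h · var ze                                 ≈⟨ η-⊗ ⟩
  pair (fst (h · var ze)) (snd (h · var ze))
    ≈⟨ ξ-pair (≈trans (≈sym (π₁-· _)) (≈trans (≈sym (∘-· LO.π₁ h _)) (·-cong p ≈refl)))
              (≈trans (≈sym (π₂-· _)) (≈trans (≈sym (∘-· LO.π₂ h _)) (·-cong q ≈refl))) ⟩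
  pair (f · var ze) (g · var ze)             ≈⟨ ⟨,⟩-· f g _ ⟨
  LO.⟨ f , g ⟩ · var ze                      ∎)
  where open ≈βη-Reasoning

Lam-curry-β : {f : Tm (C ⊗ A ⇒ B)} → LO.eval ∘L (LO.curry f LO.⊠₁ idL) ≈βη f
Lam-curry-β {f = f} = ·-ext (begin
  (LO.eval ∘L (LO.curry f LO.⊠₁ idL)) · var ze   ≈⟨ eval∘⊠₁id-· (LO.curry f) _ ⟩
  app (LO.curry f · fst (var ze)) (snd (var ze)) ≈⟨ curry-·-· f _ _ ⟩
  f · pair (fst (var ze)) (snd (var ze))         ≈⟨ ·-cong ≈refl η-⊗ ⟨
  f · var ze                                     ∎)
  where open ≈βη-Reasoning

Lam-curry-unique : {f : Tm (C ⊗ A ⇒ B)} {h : Tm (C ⇒ A ⇒ B)} →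
                   LO.eval ∘L (h LO.⊠₁ idL) ≈βη f → h ≈βη LO.curry f
Lam-curry-unique {f = f} {h} p = ·-ext (begin
  h · var ze                                                     ≈⟨ η-⇒ ⟩
  lam (app (wk (h · var ze)) (var ze))
    ≈⟨ ≡⇒≈βη (cong (λ z → lam (app (app z (var (su ze))) (var ze))) (rename-wkc su h)) ⟩
  lam (app (h · var (su ze)) (var ze))                           ≈⟨ ξ-lam (ξ-app (·-cong ≈refl β-fst) β-snd) ⟨
  lam (app (h · fst (pair (var (su ze)) (var ze))) (snd (pair (var (su ze)) (var ze))))
    ≈⟨ ξ-lam (eval∘⊠₁id-· h _) ⟨
  lam ((LO.eval ∘L (h LO.⊠₁ idL)) · pair (var (su ze)) (var ze)) ≈⟨ ξ-lam (·-cong p ≈refl) ⟩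
  lam (f · pair (wk (var ze)) (var ze))                          ≈⟨ curry-· f _ ⟨
  LO.curry f · var ze                                            ∎)
  where open ≈βη-Reasoning

Lam-isCCC : IsCCC Lam LamOps
Lam-isCCC = record
  { isCategory   = record
    { equiv     = Setoid.isEquivalence (≈βη-setoid ∅ _)
    ; ∘-resp-≈  = Lam-∘-resp-≈
    ; identityˡ = Lam-identityˡ
    ; identityʳ = Lam-identityʳ
    ; assoc     = Lam-assoc
    }
  ; !-unique     = Lam-!-unique
  ; π₁-β         = Lam-π₁-β
  ; π₂-β         = Lam-π₂-β
  ; ⟨⟩-unique    = Lam-⟨⟩-unique
  ; curry-β      = Lam-curry-β
  ; curry-unique = Lam-curry-unique
  }

app-id : (N : Tm A) → app idL N ≈βη N
app-id N = ≈trans (app-∅ idL N) (id-· N)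

app-∘ : (g : Tm (B ⇒ C)) (f : Tm (A ⇒ B)) (N : Tm A) → app (g ∘L f) N ≈βη app g (app f N)
app-∘ g f N = ≈trans (app-∅ (g ∘L f) N) (≈trans (∘-· g f N)
                     (≈trans (·-cong ≈refl (≈sym (app-∅ f N))) (≈sym (app-∅ g _))))

app-π₁ : (N : Tm (A ⊗ B)) → app LO.π₁ N ≈βη fst N
app-π₁ N = ≈trans (app-∅ LO.π₁ N) (π₁-· N)

app-π₂ : (N : Tm (A ⊗ B)) → app LO.π₂ N ≈βη snd N
app-π₂ N = ≈trans (app-∅ LO.π₂ N) (π₂-· N)

app-⟨,⟩ : (f : Tm (C ⇒ A)) (g : Tm (C ⇒ B)) (N : Tm C) → app LO.⟨ f , g ⟩ N ≈βη pair (app f N) (app g N)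
app-⟨,⟩ f g N = ≈trans (app-∅ LO.⟨ f , g ⟩ N)
                       (≈trans (⟨,⟩-· f g N) (ξ-pair (≈sym (app-∅ f N)) (≈sym (app-∅ g N))))

app-eval : (N : Tm ((A ⇒ B) ⊗ A)) → app LO.eval N ≈βη app (fst N) (snd N)
app-eval N = ≈trans (app-∅ LO.eval N) (eval-· N)

app-curry : (f : Tm (C ⊗ A ⇒ B)) (M : Tm C) (N : Tm A) → app (app (LO.curry f) M) N ≈βη app f (pair M N)
app-curry f M N = ≈trans (ξ-app (app-∅ (LO.curry f) M) ≈refl) (≈trans (curry-·-· f M N) (≈sym (app-∅ f _)))

module CCC-Properties {o ℓ e} {𝒞 : Cat o ℓ e} {ops : CCOps 𝒞} (isCCC : IsCCC 𝒞 ops) where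
  open Cat 𝒞
  open CCOps ops
  open IsCCC isCCC
  open IsCategory isCategory

  module Eq {X Y} = IsEquivalence (equiv {X} {Y})

  hom-setoid : Obj → Obj → Setoid ℓ e
  hom-setoid X Y = record { Carrier = Hom X Y ; _≈_ = _≈_ ; isEquivalence = equiv }

  module HomReasoning {X Y} = SetoidReasoning (hom-setoid X Y)

  ∘-congˡ : ∀ {X Y Z} {f : Hom Y Z} {g g′ : Hom X Y} → g ≈ g′ → f ∘ g ≈ f ∘ g′
  ∘-congˡ = ∘-resp-≈ Eq.refl

  ⟨⟩-cong : ∀ {Z X Y} {f f′ : Hom Z X} {g g′ : Hom Z Y} →
            f ≈ f′ → g ≈ g′ → ⟨ f , g ⟩ ≈ ⟨ f′ , g′ ⟩
  ⟨⟩-cong p q = ⟨⟩-unique (Eq.trans π₁-β p) (Eq.trans π₂-β q)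

  ⟨⟩∘ : ∀ {W Z X Y} {f : Hom Z X} {g : Hom Z Y} {h : Hom W Z} → ⟨ f , g ⟩ ∘ h ≈ ⟨ f ∘ h , g ∘ h ⟩
  ⟨⟩∘ = ⟨⟩-unique (Eq.trans (Eq.sym assoc) (∘-resp-≈ π₁-β Eq.refl))
                  (Eq.trans (Eq.sym assoc) (∘-resp-≈ π₂-β Eq.refl))

  ⟨π₁,π₂⟩≈id : ∀ {X Y} → ⟨ π₁ , π₂ ⟩ ≈ id {X ⊠ Y}
  ⟨π₁,π₂⟩≈id = Eq.sym (⟨⟩-unique identityʳ identityʳ)

  id⊠₁id≈id : ∀ {X Y} → id {X} ⊠₁ id {Y} ≈ id
  id⊠₁id≈id = Eq.trans (⟨⟩-cong identityˡ identityˡ) ⟨π₁,π₂⟩≈id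

  ⊠₁∘⟨⟩ : ∀ {W X X′ Y Y′} {a : Hom X X′} {b : Hom Y Y′} {f : Hom W X} {g : Hom W Y} →
          (a ⊠₁ b) ∘ ⟨ f , g ⟩ ≈ ⟨ a ∘ f , b ∘ g ⟩
  ⊠₁∘⟨⟩ = Eq.trans ⟨⟩∘ (⟨⟩-cong (Eq.trans assoc (∘-congˡ π₁-β)) (Eq.trans assoc (∘-congˡ π₂-β)))

  ⊠₁-∘ : ∀ {X X′ X″ Y Y′ Y″} {a : Hom X′ X″} {b : Hom X X′} {c : Hom Y′ Y″} {d : Hom Y Y′} →
         (a ∘ b) ⊠₁ (c ∘ d) ≈ (a ⊠₁ c) ∘ (b ⊠₁ d)
  ⊠₁-∘ = Eq.sym (Eq.trans ⊠₁∘⟨⟩ (⟨⟩-cong (Eq.sym assoc) (Eq.sym assoc)))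

  curry-cong : ∀ {Z X Y} {f f′ : Hom (Z ⊠ X) Y} → f ≈ f′ → curry f ≈ curry f′
  curry-cong p = curry-unique (Eq.trans curry-β p)

  curry∘ : ∀ {W Z X Y} {f : Hom (Z ⊠ X) Y} {h : Hom W Z} → curry f ∘ h ≈ curry (f ∘ (h ⊠₁ id))
  curry∘ {f = f} {h} = curry-unique (begin
    eval ∘ ((curry f ∘ h) ⊠₁ id)
      ≈⟨ ∘-congˡ (Eq.trans (⟨⟩-cong Eq.refl (∘-resp-≈ (Eq.sym identityˡ) Eq.refl)) ⊠₁-∘) ⟩
    eval ∘ (curry f ⊠₁ id) ∘ (h ⊠₁ id)  ≈⟨ assoc ⟨
    (eval ∘ (curry f ⊠₁ id)) ∘ (h ⊠₁ id) ≈⟨ ∘-resp-≈ curry-β Eq.refl ⟩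
    f ∘ (h ⊠₁ id)                        ∎)
    where open HomReasoning

  eval∘⟨curry,⟩ : ∀ {Z X Y} {f : Hom (Z ⊠ X) Y} {g : Hom Z X} →
                  eval ∘ ⟨ curry f , g ⟩ ≈ f ∘ ⟨ id , g ⟩
  eval∘⟨curry,⟩ {f = f} {g} = begin
    eval ∘ ⟨ curry f , g ⟩                ≈⟨ ∘-congˡ (Eq.trans ⊠₁∘⟨⟩ (⟨⟩-cong identityʳ identityˡ)) ⟨
    eval ∘ (curry f ⊠₁ id) ∘ ⟨ id , g ⟩   ≈⟨ assoc ⟨
    (eval ∘ (curry f ⊠₁ id)) ∘ ⟨ id , g ⟩ ≈⟨ ∘-resp-≈ curry-β Eq.refl ⟩
    f ∘ ⟨ id , g ⟩                        ∎
    where open HomReasoning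

module Soundness {o′ ℓ e} (S : CCC o′ ℓ e) (Q : CCC.Obj S) where
  open CCC S
  open IsCCC isCCC
  open IsCategory isCategory
  open CCC-Properties isCCC
  open Interp S Q

  ⟦_⟧s : Sub Γ Δ → Hom ⟦ Δ ⟧ctx ⟦ Γ ⟧ctx
  ⟦_⟧s {∅}     σ = !
  ⟦_⟧s {Γ ▸ A} σ = ⟨ ⟦ (λ x → σ (su x)) ⟧s , ⟦ σ ze ⟧ ⟩

  vars : Ren Γ Δ → Sub Γ Δ
  vars ρ x = var (ρ x)

  ⟦⟧s-∘ : (σ : Sub Γ Δ) (τ : Sub Γ Θ) (h : Hom ⟦ Θ ⟧ctx ⟦ Δ ⟧ctx) →
          (∀ {A} (x : Γ ∋ A) → ⟦ τ x ⟧ ≈ ⟦ σ x ⟧ ∘ h) → ⟦ τ ⟧s ≈ ⟦ σ ⟧s ∘ h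
  ⟦⟧s-∘ {∅}     σ τ h p = Eq.sym (!-unique _)
  ⟦⟧s-∘ {Γ ▸ A} σ τ h p =
    Eq.trans (⟨⟩-cong (⟦⟧s-∘ (λ x → σ (su x)) (λ x → τ (su x)) h (λ x → p (su x))) (p ze)) (Eq.sym ⟨⟩∘)

  ⟦vars-su∘⟧s : (ρ : Ren Γ Δ) → ⟦ vars (λ x → su {B = B} (ρ x)) ⟧s ≈ ⟦ vars ρ ⟧s ∘ π₁
  ⟦vars-su∘⟧s ρ = ⟦⟧s-∘ (vars ρ) _ π₁ (λ x → Eq.refl)

  ⟦vars-id⟧s : ⟦ vars {Γ} (λ x → x) ⟧s ≈ id
  ⟦vars-su⟧s : ⟦ vars {Γ} (su {B = B}) ⟧s ≈ π₁

  ⟦vars-id⟧s {∅}     = Eq.sym (!-unique id)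
  ⟦vars-id⟧s {Γ ▸ A} = Eq.trans (⟨⟩-cong (⟦vars-su⟧s {Γ} {A}) Eq.refl) ⟨π₁,π₂⟩≈id

  ⟦vars-su⟧s {Γ} {B} = Eq.trans (⟦vars-su∘⟧s {Γ = Γ} {B = B} (λ x → x)) (Eq.trans (∘-resp-≈ (⟦vars-id⟧s {Γ}) Eq.refl) identityˡ)

  ⟦exts⟧s : (σ : Sub Γ Δ) → (∀ {A} (x : Γ ∋ A) → ⟦ wk {B = B} (σ x) ⟧ ≈ ⟦ σ x ⟧ ∘ π₁) →
            ⟦ exts {B = B} σ ⟧s ≈ ⟦ σ ⟧s ⊠₁ id
  ⟦exts⟧s σ p = ⟨⟩-cong (⟦⟧s-∘ σ _ π₁ p) (Eq.sym identityˡ)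

  sub-var-sem : (σ : Sub Γ Δ) (x : Γ ∋ A) → ⟦ σ x ⟧ ≈ ⟦ x ⟧var ∘ ⟦ σ ⟧s
  sub-var-sem σ ze     = Eq.sym π₂-β
  sub-var-sem σ (su x) = Eq.trans (sub-var-sem (λ y → σ (su y)) x)
                                  (Eq.trans (∘-congˡ (Eq.sym π₁-β)) (Eq.sym assoc))

  rename-sem : (ρ : Ren Γ Δ) (M : Term Γ A) → ⟦ rename ρ M ⟧ ≈ ⟦ M ⟧ ∘ ⟦ vars ρ ⟧s
  rename-sem ρ (var x)    = sub-var-sem (vars ρ) x
  -- vars (ext ρ) and exts (vars ρ) coincide pointwise by computation.
  rename-sem ρ (lam M)    =
    Eq.trans (curry-cong (Eq.trans (rename-sem (ext ρ) M) (∘-congˡ (⟦exts⟧s (vars ρ) (λ x → Eq.refl)))))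
             (Eq.sym curry∘)
  rename-sem ρ (app M N)  =
    Eq.trans (∘-congˡ (Eq.trans (⟨⟩-cong (rename-sem ρ M) (rename-sem ρ N)) (Eq.sym ⟨⟩∘))) (Eq.sym assoc)
  rename-sem ρ (pair M N) = Eq.trans (⟨⟩-cong (rename-sem ρ M) (rename-sem ρ N)) (Eq.sym ⟨⟩∘)
  rename-sem ρ (fst M)    = Eq.trans (∘-congˡ (rename-sem ρ M)) (Eq.sym assoc)
  rename-sem ρ (snd M)    = Eq.trans (∘-congˡ (rename-sem ρ M)) (Eq.sym assoc)
  rename-sem ρ unit       = Eq.trans (!-unique _) (Eq.sym (!-unique _))

  wk-sem : (M : Term Γ A) → ⟦ wk {B = B} M ⟧ ≈ ⟦ M ⟧ ∘ π₁
  wk-sem {Γ = Γ} {B = B} M = Eq.trans (rename-sem su M) (∘-congˡ (⟦vars-su⟧s {Γ} {B}))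

  sub-sem : (σ : Sub Γ Δ) (M : Term Γ A) → ⟦ sub σ M ⟧ ≈ ⟦ M ⟧ ∘ ⟦ σ ⟧s
  sub-sem σ (var x)    = sub-var-sem σ x
  sub-sem σ (lam M)    =
    Eq.trans (curry-cong (Eq.trans (sub-sem (exts σ) M) (∘-congˡ (⟦exts⟧s σ (λ x → wk-sem (σ x))))))
             (Eq.sym curry∘)
  sub-sem σ (app M N)  =
    Eq.trans (∘-congˡ (Eq.trans (⟨⟩-cong (sub-sem σ M) (sub-sem σ N)) (Eq.sym ⟨⟩∘))) (Eq.sym assoc)
  sub-sem σ (pair M N) = Eq.trans (⟨⟩-cong (sub-sem σ M) (sub-sem σ N)) (Eq.sym ⟨⟩∘)
  sub-sem σ (fst M)    = Eq.trans (∘-congˡ (sub-sem σ M)) (Eq.sym assoc)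
  sub-sem σ (snd M)    = Eq.trans (∘-congˡ (sub-sem σ M)) (Eq.sym assoc)
  sub-sem σ unit       = Eq.trans (!-unique _) (Eq.sym (!-unique _))

  sound : {M N : Term Γ A} → M ≈βη N → ⟦ M ⟧ ≈ ⟦ N ⟧
  sound ≈refl        = Eq.refl
  sound (≈sym p)     = Eq.sym (sound p)
  sound (≈trans p q) = Eq.trans (sound p) (sound q)
  sound (ξ-lam p)    = curry-cong (sound p)
  sound (ξ-app p q)  = ∘-congˡ (⟨⟩-cong (sound p) (sound q))
  sound (ξ-pair p q) = ⟨⟩-cong (sound p) (sound q)
  sound (ξ-fst p)    = ∘-congˡ (sound p)
  sound (ξ-snd p)    = ∘-congˡ (sound p)
  sound {Γ = Γ} (β-⇒ {M = M} {N = N}) = begin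
    eval ∘ ⟨ curry ⟦ M ⟧ , ⟦ N ⟧ ⟩               ≈⟨ eval∘⟨curry,⟩ ⟩
    ⟦ M ⟧ ∘ ⟨ id , ⟦ N ⟧ ⟩                        ≈⟨ ∘-congˡ (⟨⟩-cong (⟦vars-id⟧s {Γ}) Eq.refl) ⟨
    ⟦ M ⟧ ∘ ⟨ ⟦ vars {Γ} (λ x → x) ⟧s , ⟦ N ⟧ ⟩    ≈⟨ sub-sem (single N) M ⟨
    ⟦ M [ N ] ⟧                                   ∎
    where open HomReasoning
  sound β-fst        = π₁-β
  sound β-snd        = π₂-β
  sound (η-⇒ {M = M}) = curry-unique (∘-congˡ (⟨⟩-cong (Eq.sym (wk-sem M)) identityˡ))
  sound η-⊗          = ⟨⟩-unique Eq.refl Eq.refl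
  sound η-𝟙          = !-unique _

module Recognisers {o′ ℓ e} (S : CCC o′ ℓ e) (Q : CCC.Obj S) (r : Level) where
  open RecQ S Q r
  open Interp S Q
  open Soundness S Q using (sound)
  open CCC-Properties (CCC.isCCC S) using (module Eq; ∘-congˡ; ⟨⟩-cong)

  app-cong-~Q : (f f′ : Tm (A ⇒ B)) (M N : Tm A) → f ~Q f′ → M ~Q N → app f M ~Q app f′ N
  app-cong-~Q _ _ _ _ p q = ∘-congˡ (⟨⟩-cong p q)

  pred-≈βη : (X : RecObj) {M N : Tm (ty X)} → M ≈βη N → pred X M → pred X N
  pred-≈βη X p = saturated X (sound p)

  laws : RecCatLaws
  laws = record
    { id-pres   = λ X N p → pred-≈βη X (≈sym (app-id N)) p
    ; comp-pres = λ {_} {_} {Z} (g , g-pres) (f , f-pres) N x →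
        pred-≈βη Z (≈sym (app-∘ g f N)) (g-pres _ (f-pres N x))
    }

  Rec : Cat _ _ _
  Rec = RecCat laws

  ⊤R : RecObj
  ⊤R = record { ty = 𝟙 ; pred = λ _ → Lift (e ⊔ r) Unit ; saturated = λ _ x → x }

  _×R_ : RecObj → RecObj → RecObj
  X ×R Y = record
    { ty        = ty X ⊗ ty Y
    ; pred      = λ M → pred X (fst M) × pred Y (snd M)
    ; saturated = λ p (x , y) → saturated X (∘-congˡ p) x , saturated Y (∘-congˡ p) y
    }

  _⇒R_ : RecObj → RecObj → RecObj
  X ⇒R Y = record
    { ty        = ty X ⇒ ty Y
    ; pred      = λ M → ∀ N → pred X N → pred Y (app M N)
    ; saturated = λ {M} {M′} p f N x → saturated Y (app-cong-~Q M M′ N N p Eq.refl) (f N x)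
    }

  reindex : (Y : RecObj) → Tm (A ⇒ ty Y) → RecObj
  reindex {A} Y f = record
    { ty        = A
    ; pred      = λ N → pred Y (app f N)
    ; saturated = λ {N} {N′} p → saturated Y (app-cong-~Q f f N N′ Eq.refl p)
    }

  image : (X : RecObj) → Tm (ty X ⇒ A) → RecObj
  image {A} X f = record
    { ty        = A
    ; pred      = λ M → Σ (Tm (ty X)) λ N → pred X N × app f N ~Q M
    ; saturated = λ p (N , x , fN~M) → N , x , Eq.trans fN~M p
    }

  ops : CCOps Rec
  ops = record
    { ⊤     = ⊤R
    ; !     = LO.! , λ _ _ → lift tt
    ; _⊠_   = _×R_
    ; π₁    = λ {X} → LO.π₁ , λ N (x , _) → pred-≈βη X (≈sym (app-π₁ N)) x
    ; π₂    = λ {_} {Y} → LO.π₂ , λ N (_ , y) → pred-≈βη Y (≈sym (app-π₂ N)) y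
    ; ⟨_,_⟩ = λ {_} {X} {Y} (f , f-pres) (g , g-pres) → LO.⟨ f , g ⟩ , λ N z →
        pred-≈βη X (≈sym (≈trans (ξ-fst (app-⟨,⟩ f g N)) β-fst)) (f-pres N z) ,
        pred-≈βη Y (≈sym (≈trans (ξ-snd (app-⟨,⟩ f g N)) β-snd)) (g-pres N z)
    ; _⇨_   = _⇒R_
    ; eval  = λ {_} {Y} → LO.eval , λ N (f , x) → pred-≈βη Y (≈sym (app-eval N)) (f (snd N) x)
    ; curry = λ {Z} {X} {Y} (f , f-pres) → LO.curry f , λ M z N x →
        pred-≈βη Y (≈sym (app-curry f M N))
          (f-pres (pair M N) (pred-≈βη Z (≈sym β-fst) z , pred-≈βη X (≈sym β-snd) x))
    }

  isCCC : IsCCC Rec ops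
  isCCC = record
    { isCategory   = record
      { equiv     = record { refl = ≈refl ; sym = ≈sym ; trans = ≈trans }
      ; ∘-resp-≈  = Lam-∘-resp-≈
      ; identityˡ = Lam-identityˡ
      ; identityʳ = Lam-identityʳ
      ; assoc     = Lam-assoc
      }
    ; !-unique     = λ (f , _) → Lam-!-unique f
    ; π₁-β         = Lam-π₁-β
    ; π₂-β         = Lam-π₂-β
    ; ⟨⟩-unique    = Lam-⟨⟩-unique
    ; curry-β      = Lam-curry-β
    ; curry-unique = Lam-curry-unique
    }

  strict : StrictCC ops LamOps (P laws)
  strict = record
    { ⊤-eq    = refl
    ; ⊠-eq    = λ _ _ → refl
    ; π₁-eq   = λ _ _ → ≈sym Lam-identityʳ
    ; π₂-eq   = λ _ _ → ≈sym Lam-identityʳ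
    ; ⇨-eq    = λ _ _ → refl
    ; eval-eq = λ _ _ → ≈sym (≈trans (Lam-∘-resp-≈ ≈refl (≈trans Lam-identityʳ id⊠₁id≈id)) Lam-identityʳ)
    }
    where open CCC-Properties Lam-isCCC using (id⊠₁id≈id)

  fibration : Fibration (P laws)
  fibration {A} {Y} f = reindex Y f , refl , φ , ≈sym Lam-identityʳ , λ {Z} → cartesian {Z}
    where
    φ : RecHom (reindex Y f) Y
    φ = f , λ _ y → y

    cartesian : IsCartesian (P laws) {reindex Y f} {Y} φ
    cartesian (ψ , ψ-pres) g f∘g≈ψ =
      (g , λ N z → pred-≈βη Y (≈trans (ξ-app (≈sym f∘g≈ψ) ≈refl) (app-∘ f g N)) (ψ-pres N z))
      , (≈refl , f∘g≈ψ) , λ _ χ′≈g _ → χ′≈g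

  opfibration : Opfibration (P laws)
  opfibration {X} {A} f = image X f , refl , φ , Lam-identityˡ , λ {Z} → cocartesian {Z}
    where
    φ : RecHom X (image X f)
    φ = f , λ N x → N , x , Eq.refl

    cocartesian : IsCocartesian (P laws) {X} {image X f} φ
    cocartesian {Z} (ψ , ψ-pres) g g∘f≈ψ =
      (g , λ M (N , x , fN~M) →
         saturated Z (Eq.trans (sound (≈trans (ξ-app (≈sym g∘f≈ψ) ≈refl) (app-∘ g f N)))
                               (app-cong-~Q g g (app f N) M Eq.refl fN~M))
                     (ψ-pres N x))
      , (≈refl , g∘f≈ψ) , λ _ χ′≈g _ → χ′≈g

proposition3p3 : ∀ {o′ ℓ e} (S : CCC o′ ℓ e) (Q : CCC.Obj S) (r : Level) →
    Σ (RecQ.RecCatLaws S Q r) λ L →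
    Σ (CCOps (RecQ.RecCat S Q r L)) λ ops →
      IsCCC (RecQ.RecCat S Q r L) ops
      × StrictCC ops LamOps (RecQ.P S Q r L)
      × Fibration (RecQ.P S Q r L)
      × Opfibration (RecQ.P S Q r L)
proposition3p3 S Q r =
  laws , ops , isCCC , strict , (λ {A} {Y} → fibration {A} {Y}) , (λ {X} {A} → opfibration {X} {A})
  where open Recognisers S Q r
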